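{- Let $G$ and $H$ be graphs. If there exists a homomorphism from $G$ to $H$, then ${\rm tree}\text{ - }\chi(G)\le {\rm tree}\text{ - }\chi(H)$.
   Context: A homomorphism from $G$ to $H$ is a map $f\colon V(G)\to V(H)$ with $f(u)f(v)\in E(H)$ for every $uv\in E(G)$. A tree-decomposition of a graph $G$ is a pair $(T,\{X_t\}_{t\in V(T)})$ where $T$ is a tree and $X_t\subseteq V(G)$, such that every edge of $G$ has both ends in some $X_t$ and for every vertex $v$ the nodes $t$ with $v\in X_t$ induce a non-empty connected subtree of $T$. ${\rm tree}\text{ - }\chi(G)$ is the minimum over tree-decompositions of $G$ of $\max_t\chi(G[X_t])$. -}

module Defs where

open import Data.Nat using (ℕ; suc; _≤_)
open import Data.Fin using (Fin; zero; suc; toℕ)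
open import Data.Product using (Σ; ∃; _×_)
open import Relation.Binary.PropositionalEquality using (_≡_)
open import Relation.Nullary using (¬_)
open import Level using (0ℓ)

record Graph : Set₁ where
  field
    n     : ℕ
    Adj   : Fin n → Fin n → Set
    sym   : ∀ {u v} → Adj u v → Adj v u
    irrefl : ∀ {u} → ¬ Adj u u
open Graph public

Hom : Graph → Graph → Set
Hom G H = Σ (Fin (n G) → Fin (n H)) λ f →
  ∀ {u v} → Adj G u v → Adj H (f u) (f v)

-- A finite (non-empty) tree on the node set Fin (suc size), given by a
-- parent function: node (suc i) is adjacent to its parent, which has a
-- smaller index. Every finite tree is isomorphic to one of this form
-- (number the nodes in BFS order from any root).
record Tree : Set where
  field
    size   : ℕ
    parent : Fin size → Fin (suc size)
    parent< : ∀ i → toℕ (parent i) ≤ toℕ i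
open Tree public

Node : Tree → Set
Node T = Fin (suc (size T))

data TEdge (T : Tree) : Node T → Node T → Set where
  up   : ∀ i → TEdge T (suc i) (parent T i)
  down : ∀ i → TEdge T (parent T i) (suc i)

data ReachIn (T : Tree) (S : Node T → Set) : Node T → Node T → Set where
  here : ∀ {s} → ReachIn T S s s
  step : ∀ {s t u} → TEdge T s t → S t → ReachIn T S t u → ReachIn T S s u

ConnectedNonEmpty : (T : Tree) → (Node T → Set) → Set
ConnectedNonEmpty T S =
  (∃ λ t → S t) × (∀ s t → S s → S t → ReachIn T S s t)

record TreeDecomp (G : Graph) : Set₁ where
  field
    tree : Tree
    bag  : Node tree → Fin (n G) → Set
    edgeCovered : ∀ {u v} → Adj G u v → ∃ λ t → bag t u × bag t v
    vertexConnected : ∀ v → ConnectedNonEmpty tree (λ t → bag t v)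
open TreeDecomp public

Colourable : (G : Graph) → (Fin (n G) → Set) → ℕ → Set
Colourable G X k = Σ (Fin (n G) → Fin k) λ c →
  ∀ {u v} → X u → X v → Adj G u v → ¬ (c u ≡ c v)

WidthχAtMost : (G : Graph) → TreeDecomp G → ℕ → Set
WidthχAtMost G D k = ∀ t → Colourable G (bag D t) k

TreeχAtMost : Graph → ℕ → Set₁
TreeχAtMost G k = Σ (TreeDecomp G) λ D → WidthχAtMost G D k

IsTreeχ : Graph → ℕ → Set₁
IsTreeχ G k = TreeχAtMost G k × (∀ j → TreeχAtMost G j → k ≤ j)

{-# OPTIONS --safe #-}
-- The preimages f⁻¹(X_t) of the bags of a tree-decomposition of H form one of G
-- on the same tree: the nodes whose bag contains v are those whose bag contains
-- f v, and an edge uv is covered wherever f u f v is.  A proper colouring c of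
-- H[X_t] pulls back to the proper colouring c ∘ f of G[f⁻¹(X_t)].
module Submission where

open import Defs
open import Data.Nat using (_≤_)
open import Data.Fin using (Fin)
open import Data.Product using (_,_; proj₁; proj₂)
open import Function using (_∘_)

module _ {G H : Graph} (h : Hom G H) where

  private
    f : Fin (n G) → Fin (n H)
    f = proj₁ h

    f-hom : ∀ {u v} → Adj G u v → Adj H (f u) (f v)
    f-hom = proj₂ h

  comapDecomp : TreeDecomp H → TreeDecomp G
  comapDecomp D = record
    { tree            = tree D
    ; bag             = λ t → bag D t ∘ f
    ; edgeCovered     = edgeCovered D ∘ f-hom
    ; vertexConnected = vertexConnected D ∘ f
    }

  comapColourable : ∀ {X k} → Colourable H X k → Colourable G (X ∘ f) k
  comapColourable (c , c-proper) = c ∘ f , λ xu xv → c-proper xu xv ∘ f-hom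

  comapTreeχAtMost : ∀ {k} → TreeχAtMost H k → TreeχAtMost G k
  comapTreeχAtMost (D , D-width) = comapDecomp D , comapColourable ∘ D-width

lemma3p3 : ∀ (G H : Graph) → Hom G H →
    ∀ a b → IsTreeχ G a → IsTreeχ H b → a ≤ b
lemma3p3 G H h a b (_ , a-minimal) (b-attained , _) =
  a-minimal b (comapTreeχAtMost h b-attained)
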